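{- Let $A$ be a finite simplicial complex. Then the category $\mathcal{S}(A)$ of selections on $A$ is a projective Fra\"iss\'e category.
   Context: A simplicial complex is a family of finite non-empty sets closed under non-empty subsets; $\mathrm{dom}(C)=\bigcup C$; for $f\colon\mathrm{dom}(C)\to\mathrm{dom}(D)$, $f_*(\sigma)=\{f(v):v\in\sigma\}$, and $f$ is simplicial if $f_*(\sigma)\in D$ for all $\sigma\in C$. The barycentric subdivision $\beta C$ has vertex set $C$ and faces the non-empty chains under inclusion of faces of $C$; $\beta^0C=C$, $\beta^{k+1}C=\beta(\beta^kC)$. For simplicial $f\colon C\to D$, $\beta f\colon\beta C\to\beta D$ is $\sigma\mapsto f_*(\sigma)$. An elementary selection is a map $s\colon\beta C\to C$ with $s(\sigma)\in\sigma$ for every $\sigma\in C$ (it is a simplicial surjection). $\mathcal{S}(A)$ is the smallest family of simplicial maps that contains all elementary selections $\beta^{k+1}A\to\beta^kA$ ($k\ge0$) and the identity $1_A$, and is closed under composition and under $f\mapsto\beta f$; it is a category with objects $\beta^kA$, $k\ge0$. A category $\mathcal E$ is essentially countable if its objects are countably many up to isomorphism and there are countably many morphisms between any two objects. A projective Fra\"iss\'e category is an essentially countable category with (joint projection) for any objects $o_1,o_2$ there are morphisms $e_1,e_2$ with $\mathrm{codom}(e_i)=o_i$ and $\mathrm{dom}(e_1)=\mathrm{dom}(e_2)$, and (projective amalgamation) for any morphisms $e_1,e_2$ with the same codomain there are morphisms $e_1',e_2'$ with $e_1\circ e_1'=e_2\circ e_2'$. -}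

module Defs where

open import Data.Nat using (ℕ; zero; suc)
open import Data.Bool using (Bool; true; false; _∧_; _∨_; T)
open import Data.List using (List; []; _∷_; map; foldr)
open import Data.Bool.ListAction using (all; any)
open import Data.List.Membership.Propositional using (_∈_)
open import Data.Fin using (Fin; toℕ)
open import Data.Product using (Σ; _,_; proj₁; proj₂; _×_)
open import Data.Maybe using (Maybe; just)
open import Relation.Binary.PropositionalEquality using (_≡_)
open import Function using (_∘_; id)

-- Three-way comparison, used only to keep finite sets in a canonical
-- form (strictly increasing lists), so that equality of finite sets is
-- propositional equality of their representing lists.

data Cmp : Set where
  lt eq gt : Cmp

cmpℕ : ℕ → ℕ → Cmp
cmpℕ zero    zero    = eq
cmpℕ zero    (suc _) = lt
cmpℕ (suc _) zero    = gt
cmpℕ (suc m) (suc n) = cmpℕ m n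

cmpFin : ∀ {n} → Fin n → Fin n → Cmp
cmpFin i j = cmpℕ (toℕ i) (toℕ j)

module _ {X : Set} (cmp : X → X → Cmp) where

  lexCmp : List X → List X → Cmp
  lexCmp []       []       = eq
  lexCmp []       (_ ∷ _)  = lt
  lexCmp (_ ∷ _)  []       = gt
  lexCmp (x ∷ xs) (y ∷ ys) with cmp x y
  ... | lt = lt
  ... | gt = gt
  ... | eq = lexCmp xs ys

  eqᵇ : X → X → Bool
  eqᵇ x y with cmp x y
  ... | eq = true
  ... | lt = false
  ... | gt = false

  ltᵇ : X → X → Bool
  ltᵇ x y with cmp x y
  ... | lt = true
  ... | eq = false
  ... | gt = false

  increasing : List X → Bool
  increasing []           = true
  increasing (x ∷ [])     = true
  increasing (x ∷ y ∷ ys) = ltᵇ x y ∧ increasing (y ∷ ys)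

  nonempty : List X → Bool
  nonempty []      = false
  nonempty (_ ∷ _) = true

  canonᵇ : List X → Bool
  canonᵇ xs = nonempty xs ∧ increasing xs

  ins : X → List X → List X
  ins x []       = x ∷ []
  ins x (y ∷ ys) with cmp x y
  ... | lt = x ∷ y ∷ ys
  ... | eq = y ∷ ys
  ... | gt = y ∷ ins x ys

  normalize : List X → List X
  normalize = foldr ins []

  subᵇ : List X → List X → Bool
  subᵇ xs ys = all (λ x → any (eqᵇ x) ys) xs

-- Simplicial complexes.  V is dom(C); a face is a canonical list σ with
-- T (face σ).

record Cx : Set₁ where
  field
    V    : Set
    cmp  : V → V → Cmp
    face : List V → Bool

open Cx public

IsFace : (C : Cx) → List (V C) → Set
IsFace C σ = T (face C σ)

image : (C D : Cx) → (V C → V D) → List (V C) → List (V D)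
image C D f σ = normalize (cmp D) (map f σ)

Simplicial : (C D : Cx) → (V C → V D) → Set
Simplicial C D f = ∀ σ → IsFace C σ → IsFace D (image C D f σ)

module _ (C : Cx) where
  Vβ : Set
  Vβ = Σ (List (V C)) (IsFace C)

  cmpβ : Vβ → Vβ → Cmp
  cmpβ a b = lexCmp (cmp C) (proj₁ a) (proj₁ b)

  comparableᵇ : Vβ → Vβ → Bool
  comparableᵇ a b = subᵇ (cmp C) (proj₁ a) (proj₁ b) ∨ subᵇ (cmp C) (proj₁ b) (proj₁ a)

  chainᵇ : List Vβ → Bool
  chainᵇ τ = all (λ a → all (λ b → comparableᵇ a b) τ) τ

  faceβ : List Vβ → Bool
  faceβ τ = canonᵇ cmpβ τ ∧ chainᵇ τ

β : Cx → Cx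
β C = record { V = Vβ C ; cmp = cmpβ C ; face = faceβ C }

β^ : ℕ → Cx → Cx
β^ zero    C = C
β^ (suc k) C = β (β^ k C)

βmap : (C D : Cx) (f : V C → V D) → Simplicial C D f → V (β C) → V (β D)
βmap C D f p (σ , q) = image C D f σ , p σ q

IsSelection : (C : Cx) → (V (β C) → V C) → Set
IsSelection C s = ∀ σ → s σ ∈ proj₁ σ

-- The category S(A): objects k (standing for β^k A); a morphism
-- β^m A → β^k A is a vertex map belonging to the smallest family
-- containing the elementary selections and 1_A, closed under
-- composition and under β.

data InS (A : Cx) : (m k : ℕ) → (V (β^ m A) → V (β^ k A)) → Set where
  sel  : ∀ k (s : V (β^ (suc k) A) → V (β^ k A)) →
         IsSelection (β^ k A) s → InS A (suc k) k s
  idA  : InS A 0 0 id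
  comp : ∀ {j m k f g} → InS A m k f → InS A j m g → InS A j k (f ∘ g)
  bet  : ∀ {m k f} (p : Simplicial (β^ m A) (β^ k A) f) → InS A m k f →
         InS A (suc m) (suc k) (βmap (β^ m A) (β^ k A) f p)

Hom : Cx → ℕ → ℕ → Set
Hom A m k = Σ (V (β^ m A) → V (β^ k A)) (InS A m k)

_≈ₕ_ : ∀ {A m k} → Hom A m k → Hom A m k → Set
f ≈ₕ g = ∀ x → proj₁ f x ≡ proj₁ g x

Iso : Cx → ℕ → ℕ → Set
Iso A m k = Σ (Hom A m k) λ f → Σ (Hom A k m) λ g →
  (∀ x → proj₁ f (proj₁ g x) ≡ x) × (∀ x → proj₁ g (proj₁ f x) ≡ x)

Countable : (H : Set) → (H → H → Set) → Set
Countable H _≈_ = Σ (ℕ → Maybe H) λ e → ∀ h → Σ ℕ λ n → Σ H λ h' → (e n ≡ just h') × (h' ≈ h)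

record ProjFraisse (A : Cx) : Set where
  field
    countableObjects : Σ (ℕ → ℕ) λ e → ∀ k → Σ ℕ λ n → Iso A (e n) k
    countableHoms    : ∀ m k → Countable (Hom A m k) _≈ₕ_
    jointProjection  : ∀ o₁ o₂ → Σ ℕ λ o → Hom A o o₁ × Hom A o o₂
    amalgamation     : ∀ {o₁ o₂ o₃} (e₁ : Hom A o₁ o₃) (e₂ : Hom A o₂ o₃) →
      Σ ℕ λ o → Σ (Hom A o o₁) λ e₁' → Σ (Hom A o o₂) λ e₂' →
        ∀ x → proj₁ e₁ (proj₁ e₁' x) ≡ proj₁ e₂ (proj₁ e₂' x)

baseCx : (n : ℕ) → (List (Fin n) → Bool) → Cx
baseCx n F = record { V = Fin n ; cmp = cmpFin ; face = λ σ → canonᵇ cmpFin σ ∧ F σ }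

record IsComplex (n : ℕ) (F : List (Fin n) → Bool) : Set where
  field
    downClosed : ∀ σ τ → IsFace (baseCx n F) σ → T (canonᵇ cmpFin τ) →
                 (∀ x → x ∈ τ → x ∈ σ) → IsFace (baseCx n F) τ
    covers     : ∀ (v : Fin n) → Σ (List (Fin n)) λ σ → IsFace (baseCx n F) σ × v ∈ σ

module Submission where

-- In S(A) every morphism equals a path of generators β^j s (normal-form).  Two
-- generators with a common codomain complete to a square of generators, hence
-- so do two paths: projective amalgamation.  Joint projection iterates the
-- first-vertex selection; objects are indexed by ℕ; morphisms are countable
-- since vertices, generators and paths of bounded length can be listed.

open import Defs
open import Data.Nat using (ℕ; zero; suc; _+_; _≤_; s≤s)
open import Data.Nat.Properties
  using (+-comm; +-suc; m≤m+n; ≤-trans; ≤-reflexive) renaming (_≟_ to _≟ℕ_)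
open import Data.Fin using (Fin; toℕ)
open import Data.Fin.Properties using (toℕ-injective)
open import Data.Bool using (Bool; T)
open import Data.Bool.Properties using (T-irrelevant; T-∧; T-∨)
open import Data.Empty using (⊥; ⊥-elim)
open import Data.Unit using (⊤)
open import Data.Maybe using (just)
open import Data.Product using (Σ; _,_; proj₁; proj₂; _×_)
open import Data.Sum using (_⊎_; inj₁; inj₂; [_,_])
open import Data.List using (List; []; _∷_; map; _++_; head; drop; cartesianProductWith; allFin)
open import Data.List.Properties using (map-cong; map-id)
open import Data.List.Membership.Propositional using (_∈_; mapWith∈)
open import Data.List.Membership.Propositional.Properties
  using (∈-map⁺; ∈-map⁻; ∈-++⁺ˡ; ∈-++⁺ʳ; ∈-cartesianProductWith⁺; ∈-allFin)
open import Data.List.Relation.Binary.Subset.Propositional using (_⊆_)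
open import Data.List.Relation.Unary.All as All using (All; []; _∷_)
open import Data.List.Relation.Unary.All.Properties using (all⁺; all⁻)
open import Data.List.Relation.Unary.Any as Any using (here; there)
open import Data.List.Relation.Unary.Any.Properties using (any⁺; any⁻; mapWith∈⁺)
open import Data.List.Relation.Unary.AllPairs using (AllPairs; []; _∷_)
open import Function using (_∘_; id)
open import Function.Bundles using (Equivalence)
open import Relation.Nullary using (¬_; yes; no)
open import Relation.Nullary.Decidable using (T?)
open import Relation.Binary.Definitions using (DecidableEquality)
open import Relation.Binary.PropositionalEquality
  using (_≡_; refl; sym; trans; cong; cong₂; subst; _≗_; module ≡-Reasoning)

face-≡ : ∀ {X : Set} {P : X → Bool} {a b : X} {p : T (P a)} {q : T (P b)} →
         a ≡ b → _≡_ {A = Σ X (T ∘ P)} (a , p) (b , q)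
face-≡ {p = p} {q} refl = cong (_ ,_) (T-irrelevant p q)

record IsCmpOrder {X : Set} (c : X → X → Cmp) : Set where
  field
    eq⇒≡     : ∀ {x y} → c x y ≡ eq → x ≡ y
    eq-refl  : ∀ x → c x x ≡ eq
    lt⇒gt    : ∀ {x y} → c x y ≡ lt → c y x ≡ gt
    gt⇒lt    : ∀ {x y} → c x y ≡ gt → c y x ≡ lt
    lt-trans : ∀ {x y z} → c x y ≡ lt → c y z ≡ lt → c x z ≡ lt

cmpℕ-order : IsCmpOrder cmpℕ
cmpℕ-order = record
  { eq⇒≡     = λ {m} {n} → eq⇒≡ {m} {n}
  ; eq-refl  = eq-refl
  ; lt⇒gt    = λ {m} {n} → lt⇒gt {m} {n}
  ; gt⇒lt    = λ {m} {n} → gt⇒lt {m} {n}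
  ; lt-trans = λ {m} {n} {k} → lt-trans {m} {n} {k} }
  where
  eq⇒≡ : ∀ {m n} → cmpℕ m n ≡ eq → m ≡ n
  eq⇒≡ {zero}  {zero}  _ = refl
  eq⇒≡ {suc m} {suc n} e = cong suc (eq⇒≡ e)

  eq-refl : ∀ m → cmpℕ m m ≡ eq
  eq-refl zero    = refl
  eq-refl (suc m) = eq-refl m

  lt⇒gt : ∀ {m n} → cmpℕ m n ≡ lt → cmpℕ n m ≡ gt
  lt⇒gt {zero}  {suc n} _ = refl
  lt⇒gt {suc m} {suc n} e = lt⇒gt {m} e

  gt⇒lt : ∀ {m n} → cmpℕ m n ≡ gt → cmpℕ n m ≡ lt
  gt⇒lt {suc m} {zero}  _ = refl
  gt⇒lt {suc m} {suc n} e = gt⇒lt {m} e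

  lt-trans : ∀ {m n k} → cmpℕ m n ≡ lt → cmpℕ n k ≡ lt → cmpℕ m k ≡ lt
  lt-trans {zero}  {suc n} {suc k} _ _ = refl
  lt-trans {suc m} {suc n} {suc k} e f = lt-trans {m} e f

cmpFin-order : ∀ n → IsCmpOrder (cmpFin {n})
cmpFin-order n = record
  { eq⇒≡     = toℕ-injective ∘ eq⇒≡
  ; eq-refl  = eq-refl ∘ toℕ
  ; lt⇒gt    = λ {x} → lt⇒gt {toℕ x}
  ; gt⇒lt    = λ {x} → gt⇒lt {toℕ x}
  ; lt-trans = λ {x} → lt-trans {toℕ x} }
  where open IsCmpOrder cmpℕ-order

lex-order : ∀ {X : Set} {c : X → X → Cmp} → IsCmpOrder c → IsCmpOrder (lexCmp c)
lex-order {X} {c} O = record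
  { eq⇒≡     = λ {xs} {ys} → leq⇒≡ {xs} {ys}
  ; eq-refl  = leq-refl
  ; lt⇒gt    = λ {xs} {ys} → llt⇒gt {xs} {ys}
  ; gt⇒lt    = λ {xs} {ys} → lgt⇒lt {xs} {ys}
  ; lt-trans = λ {xs} {ys} {zs} → llt-trans {xs} {ys} {zs} }
  where
  open IsCmpOrder O
  L : List X → List X → Cmp
  L = lexCmp c

  leq⇒≡ : ∀ {xs ys} → L xs ys ≡ eq → xs ≡ ys
  leq⇒≡ {[]}     {[]}     _ = refl
  leq⇒≡ {x ∷ xs} {y ∷ ys} e with c x y in h
  ... | eq = cong₂ _∷_ (eq⇒≡ h) (leq⇒≡ e)

  leq-refl : ∀ xs → L xs xs ≡ eq
  leq-refl []       = refl
  leq-refl (x ∷ xs) rewrite eq-refl x = leq-refl xs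

  llt⇒gt : ∀ {xs ys} → L xs ys ≡ lt → L ys xs ≡ gt
  llt⇒gt {[]}     {_ ∷ _}  _ = refl
  llt⇒gt {x ∷ xs} {y ∷ ys} e with c x y in h
  ... | lt rewrite lt⇒gt h = refl
  ... | eq rewrite eq⇒≡ h | eq-refl y = llt⇒gt {xs} e

  lgt⇒lt : ∀ {xs ys} → L xs ys ≡ gt → L ys xs ≡ lt
  lgt⇒lt {_ ∷ _}  {[]}     _ = refl
  lgt⇒lt {x ∷ xs} {y ∷ ys} e with c x y in h
  ... | gt rewrite gt⇒lt h = refl
  ... | eq rewrite eq⇒≡ h | eq-refl y = lgt⇒lt {xs} e

  llt-trans : ∀ {xs ys zs} → L xs ys ≡ lt → L ys zs ≡ lt → L xs zs ≡ lt
  llt-trans {[]}     {_ ∷ _}  {_ ∷ _}  _ _ = refl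
  llt-trans {x ∷ xs} {y ∷ ys} {z ∷ zs} e f with c x y in h₁ | c y z in h₂
  ... | lt | lt rewrite lt-trans h₁ h₂ = refl
  ... | lt | eq rewrite sym (eq⇒≡ h₂) | h₁ = refl
  ... | eq | lt rewrite eq⇒≡ h₁ | h₂ = refl
  ... | eq | eq rewrite eq⇒≡ h₁ | eq⇒≡ h₂ | eq-refl z = llt-trans {xs} e f

cmpβ-order : ∀ (C : Cx) → IsCmpOrder (cmp C) → IsCmpOrder (cmpβ C)
cmpβ-order C O = record
  { eq⇒≡     = face-≡ ∘ eq⇒≡
  ; eq-refl  = eq-refl ∘ proj₁
  ; lt⇒gt    = λ {a} {b} → lt⇒gt {proj₁ a} {proj₁ b}
  ; gt⇒lt    = λ {a} {b} → gt⇒lt {proj₁ a} {proj₁ b}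
  ; lt-trans = λ {a} {b} {d} → lt-trans {proj₁ a} {proj₁ b} {proj₁ d} }
  where open IsCmpOrder (lex-order O)

Sorted : ∀ {X : Set} → (X → X → Cmp) → List X → Set
Sorted c = AllPairs (λ x y → c x y ≡ lt)

NonEmpty : ∀ {X : Set} → List X → Set
NonEmpty []      = ⊥
NonEmpty (_ ∷ _) = ⊤

∈⇒nonEmpty : ∀ {X : Set} {x : X} {xs} → x ∈ xs → NonEmpty xs
∈⇒nonEmpty (here _)  = _
∈⇒nonEmpty (there _) = _

module Canonical {X : Set} {c : X → X → Cmp} (O : IsCmpOrder c) where
  open IsCmpOrder O

  _<_ : X → X → Set
  x < y = c x y ≡ lt

  <-irrefl : ∀ {x} → ¬ x < x
  <-irrefl {x} x<x with () ← trans (sym (eq-refl x)) x<x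

  <-asym : ∀ {x y} → x < y → ¬ y < x
  <-asym x<y y<x = <-irrefl (lt-trans x<y y<x)

  _≟_ : DecidableEquality X
  x ≟ y with c x y in e
  ... | eq = yes (eq⇒≡ e)
  ... | lt = no λ { refl → <-irrefl e }
  ... | gt = no λ { refl → <-irrefl (gt⇒lt e) }

  ltᵇ⇒< : ∀ {x y} → T (ltᵇ c x y) → x < y
  ltᵇ⇒< {x} {y} t with c x y
  ... | lt = refl

  <⇒ltᵇ : ∀ {x y} → x < y → T (ltᵇ c x y)
  <⇒ltᵇ x<y rewrite x<y = _

  ∷-sorted : ∀ {x y ys} → x < y → Sorted c (y ∷ ys) → Sorted c (x ∷ y ∷ ys)
  ∷-sorted x<y s@(y<ys ∷ _) = (x<y ∷ All.map (lt-trans x<y) y<ys) ∷ s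

  increasing⇒sorted : ∀ xs → T (increasing c xs) → Sorted c xs
  increasing⇒sorted []           _ = []
  increasing⇒sorted (x ∷ [])     _ = [] ∷ []
  increasing⇒sorted (x ∷ y ∷ ys) t =
    let x<y , t′ = Equivalence.to (T-∧ {ltᵇ c x y}) t
    in ∷-sorted (ltᵇ⇒< x<y) (increasing⇒sorted (y ∷ ys) t′)

  sorted⇒increasing : ∀ {xs} → Sorted c xs → T (increasing c xs)
  sorted⇒increasing []                        = _
  sorted⇒increasing (_ ∷ [])                  = _
  sorted⇒increasing ((x<y ∷ _) ∷ s@(_ ∷ _)) =
    Equivalence.from T-∧ (<⇒ltᵇ x<y , sorted⇒increasing s)

  canonical⇒ : ∀ xs → T (canonᵇ c xs) → NonEmpty xs × Sorted c xs
  canonical⇒ (x ∷ xs) t = _ , increasing⇒sorted (x ∷ xs) t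

  ⇒canonical : ∀ {xs} → NonEmpty xs → Sorted c xs → T (canonᵇ c xs)
  ⇒canonical {_ ∷ _} _ s = sorted⇒increasing s

  ∈-ins⁻ : ∀ {z x} ys → z ∈ ins c x ys → z ≡ x ⊎ z ∈ ys
  ∈-ins⁻ [] (here e) = inj₁ e
  ∈-ins⁻ {x = x} (y ∷ ys) m with c x y | m
  ... | lt | here e  = inj₁ e
  ... | lt | there m = inj₂ m
  ... | eq | m       = inj₂ m
  ... | gt | here e  = inj₂ (here e)
  ... | gt | there m = [ inj₁ , inj₂ ∘ there ] (∈-ins⁻ ys m)

  ∈-ins⁺ : ∀ {z x} ys → z ≡ x ⊎ z ∈ ys → z ∈ ins c x ys
  ∈-ins⁺ [] (inj₁ e) = here e
  ∈-ins⁺ {x = x} (y ∷ ys) m with c x y in h | m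
  ... | lt | inj₁ e         = here e
  ... | lt | inj₂ m         = there m
  ... | eq | inj₁ refl      = here (eq⇒≡ h)
  ... | eq | inj₂ m         = m
  ... | gt | inj₁ e         = there (∈-ins⁺ ys (inj₁ e))
  ... | gt | inj₂ (here e)  = here e
  ... | gt | inj₂ (there m) = there (∈-ins⁺ ys (inj₂ m))

  ins-sorted : ∀ x {ys} → Sorted c ys → Sorted c (ins c x ys)
  ins-sorted x [] = [] ∷ []
  ins-sorted x (_∷_ {y} {ys} y<ys s) with c x y in h
  ... | lt = ∷-sorted h (y<ys ∷ s)
  ... | eq = y<ys ∷ s
  ... | gt = All.tabulate below ∷ ins-sorted x s
    where
    below : ∀ {z} → z ∈ ins c x ys → y < z
    below m = [ (λ { refl → gt⇒lt h }) , All.lookup y<ys ] (∈-ins⁻ ys m)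

  normalize-sorted : ∀ xs → Sorted c (normalize c xs)
  normalize-sorted []       = []
  normalize-sorted (x ∷ xs) = ins-sorted x (normalize-sorted xs)

  ∈-normalize⁻ : ∀ xs → normalize c xs ⊆ xs
  ∈-normalize⁻ (x ∷ xs) m with ∈-ins⁻ (normalize c xs) m
  ... | inj₁ e = here e
  ... | inj₂ m′ = there (∈-normalize⁻ xs m′)

  ∈-normalize⁺ : ∀ xs → xs ⊆ normalize c xs
  ∈-normalize⁺ (x ∷ xs) (here e)  = ∈-ins⁺ (normalize c xs) (inj₁ e)
  ∈-normalize⁺ (x ∷ xs) (there m) = ∈-ins⁺ (normalize c xs) (inj₂ (∈-normalize⁺ xs m))

  ⊆-tail : ∀ {u v us vs} → u ≡ v → All (u <_) us → (u ∷ us) ⊆ (v ∷ vs) → us ⊆ vs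
  ⊆-tail refl u<us sub m with sub (there m)
  ... | here refl = ⊥-elim (<-irrefl (All.lookup u<us m))
  ... | there m′  = m′

  sorted-ext : ∀ {xs ys} → Sorted c xs → Sorted c ys → xs ⊆ ys → ys ⊆ xs → xs ≡ ys
  sorted-ext [] [] _ _ = refl
  sorted-ext [] (_ ∷ _) _ ys⊆xs with () ← ys⊆xs (here refl)
  sorted-ext (_ ∷ _) [] xs⊆ys _ with () ← xs⊆ys (here refl)
  sorted-ext (_∷_ {x} x<xs s) (_∷_ {y} y<ys t) xs⊆ys ys⊆xs =
    cong₂ _∷_ x≡y (sorted-ext s t (⊆-tail x≡y x<xs xs⊆ys) (⊆-tail (sym x≡y) y<ys ys⊆xs))
    where
    x≡y : x ≡ y
    x≡y with xs⊆ys (here refl) | ys⊆xs (here refl)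
    ... | here e  | _       = e
    ... | there _ | here e  = sym e
    ... | there m | there n = ⊥-elim (<-asym (All.lookup y<ys m) (All.lookup x<xs n))

  normalize-id : ∀ {xs} → Sorted c xs → normalize c xs ≡ xs
  normalize-id {xs} s = sorted-ext (normalize-sorted xs) s (∈-normalize⁻ xs) (∈-normalize⁺ xs)

  normalize-ext : ∀ xs ys → xs ⊆ ys → ys ⊆ xs → normalize c xs ≡ normalize c ys
  normalize-ext xs ys xs⊆ys ys⊆xs = sorted-ext (normalize-sorted xs) (normalize-sorted ys)
    (∈-normalize⁺ ys ∘ xs⊆ys ∘ ∈-normalize⁻ xs) (∈-normalize⁺ xs ∘ ys⊆xs ∘ ∈-normalize⁻ ys)

  eqᵇ⇒≡ : ∀ {x y} → T (eqᵇ c x y) → x ≡ y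
  eqᵇ⇒≡ {x} {y} t with c x y in e
  ... | eq = eq⇒≡ e

  eqᵇ-refl : ∀ x → T (eqᵇ c x x)
  eqᵇ-refl x rewrite eq-refl x = _

  subᵇ⇒⊆ : ∀ xs ys → T (subᵇ c xs ys) → xs ⊆ ys
  subᵇ⇒⊆ xs ys t m = Any.map eqᵇ⇒≡ (any⁻ _ ys (All.lookup (all⁺ _ xs t) m))

  ⊆⇒subᵇ : ∀ xs ys → xs ⊆ ys → T (subᵇ c xs ys)
  ⊆⇒subᵇ xs ys sub = all⁻ _ (All.tabulate λ m → any⁺ _ (Any.map (λ { refl → eqᵇ-refl _ }) (sub m)))

module Images (C D : Cx) (OD : IsCmpOrder (cmp D)) where
  open Canonical OD

  ∈-image⁻ : ∀ {f : V C → V D} σ {y} → y ∈ image C D f σ → Σ (V C) λ x → x ∈ σ × y ≡ f x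
  ∈-image⁻ σ m = ∈-map⁻ _ (∈-normalize⁻ (map _ σ) m)

  ∈-image⁺ : ∀ {f : V C → V D} {σ x} → x ∈ σ → f x ∈ image C D f σ
  ∈-image⁺ {σ = σ} m = ∈-normalize⁺ (map _ σ) (∈-map⁺ _ m)

  image-mono : ∀ (f : V C → V D) {σ σ′} → σ ⊆ σ′ → image C D f σ ⊆ image C D f σ′
  image-mono f {σ} σ⊆σ′ m with x , x∈σ , refl ← ∈-image⁻ σ m = ∈-image⁺ (σ⊆σ′ x∈σ)

  image-canonical : ∀ (f : V C → V D) σ → NonEmpty σ → T (canonᵇ (cmp D) (image C D f σ))
  image-canonical f (x ∷ σ) _ =
    ⇒canonical (∈⇒nonEmpty (∈-image⁺ {f} {x ∷ σ} (here refl))) (normalize-sorted (map f (x ∷ σ)))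

image-cong : ∀ {C D : Cx} {f g : V C → V D} → f ≗ g → ∀ σ → image C D f σ ≡ image C D g σ
image-cong {D = D} f≗g σ = cong (normalize (cmp D)) (map-cong f≗g σ)

image-∘ : ∀ {C D E : Cx} → IsCmpOrder (cmp D) → IsCmpOrder (cmp E) →
          ∀ (f : V D → V E) (g : V C → V D) σ →
          image D E f (image C D g σ) ≡ image C E (f ∘ g) σ
image-∘ {C} {D} {E} OD OE f g σ = normalize-ext _ _ forth back
  where
  open Canonical OE
  open Images C D OD using (∈-image⁻; ∈-image⁺)
  forth : map f (image C D g σ) ⊆ map (f ∘ g) σ
  forth m with y , y∈gσ , refl ← ∈-map⁻ f m with x , x∈σ , refl ← ∈-image⁻ σ y∈gσ =
    ∈-map⁺ (f ∘ g) x∈σ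
  back : map (f ∘ g) σ ⊆ map f (image C D g σ)
  back m with x , x∈σ , refl ← ∈-map⁻ (f ∘ g) m = ∈-map⁺ f (∈-image⁺ x∈σ)

image-id : ∀ {C : Cx} (O : IsCmpOrder (cmp C)) {g : V C → V C} → g ≗ id →
           ∀ {σ} → Sorted (cmp C) σ → image C C g σ ≡ σ
image-id {C} O g≗id {σ} s = begin
  normalize (cmp C) (map _ σ) ≡⟨ cong (normalize (cmp C)) (trans (map-cong g≗id σ) (map-id σ)) ⟩
  normalize (cmp C) σ         ≡⟨ Canonical.normalize-id O s ⟩
  σ                           ∎
  where open ≡-Reasoning

record Regular (C : Cx) : Set where
  field
    order          : IsCmpOrder (cmp C)
    face-canonical : ∀ σ → IsFace C σ → T (canonᵇ (cmp C) σ)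
    down-closed    : ∀ σ τ → IsFace C σ → T (canonᵇ (cmp C) τ) → τ ⊆ σ → IsFace C τ

face-sorted : ∀ {C} → Regular C → ∀ {σ} → IsFace C σ → Sorted (cmp C) σ
face-sorted R {σ} σ-face =
  proj₂ (Canonical.canonical⇒ (Regular.order R) σ (Regular.face-canonical R σ σ-face))

module Subdivision (C : Cx) (O : IsCmpOrder (cmp C)) where
  open Canonical O using (subᵇ⇒⊆; ⊆⇒subᵇ)

  Comparable : Vβ C → Vβ C → Set
  Comparable a b = proj₁ a ⊆ proj₁ b ⊎ proj₁ b ⊆ proj₁ a

  IsChain : List (Vβ C) → Set
  IsChain τ = ∀ {a b} → a ∈ τ → b ∈ τ → Comparable a b

  chainᵇ⇒ : ∀ τ → T (chainᵇ C τ) → IsChain τ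
  chainᵇ⇒ τ t a∈τ b∈τ with Equivalence.to T-∨ (All.lookup (all⁺ _ τ (All.lookup (all⁺ _ τ t) a∈τ)) b∈τ)
  ... | inj₁ a⊆b = inj₁ (subᵇ⇒⊆ _ _ a⊆b)
  ... | inj₂ b⊆a = inj₂ (subᵇ⇒⊆ _ _ b⊆a)

  ⇒chainᵇ : ∀ τ → IsChain τ → T (chainᵇ C τ)
  ⇒chainᵇ τ ch = all⁻ _ (All.tabulate λ {a} a∈τ → all⁻ _ (All.tabulate λ {b} b∈τ →
    reflect {a} {b} (ch a∈τ b∈τ)))
    where
    reflect : ∀ {a b} → Comparable a b → T (comparableᵇ C a b)
    reflect (inj₁ a⊆b) = Equivalence.from T-∨ (inj₁ (⊆⇒subᵇ _ _ a⊆b))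
    reflect (inj₂ b⊆a) = Equivalence.from T-∨ (inj₂ (⊆⇒subᵇ _ _ b⊆a))

  faceβ⇒ : ∀ τ → IsFace (β C) τ → T (canonᵇ (cmpβ C) τ) × IsChain τ
  faceβ⇒ τ t = let can , ch = Equivalence.to T-∧ t in can , chainᵇ⇒ τ ch

  ⇒faceβ : ∀ τ → T (canonᵇ (cmpβ C) τ) → IsChain τ → IsFace (β C) τ
  ⇒faceβ τ can ch = Equivalence.from T-∧ (can , ⇒chainᵇ τ ch)

  chain-max : ∀ τ → NonEmpty τ → IsChain τ →
              Σ (Vβ C) λ M → M ∈ τ × (∀ {a} → a ∈ τ → proj₁ a ⊆ proj₁ M)
  chain-max (a ∷ []) _ _ = a , here refl , λ { (here refl) → id }
  chain-max (a ∷ b ∷ τ) _ ch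
    with M , M∈ , below ← chain-max (b ∷ τ) _ (λ p q → ch (there p) (there q))
    with ch (here refl) (there M∈)
  ... | inj₁ a⊆M = M , there M∈ , λ { (here refl) → a⊆M ; (there p) → below p }
  ... | inj₂ M⊆a = a , here refl , λ { (here refl) → id ; (there p) → M⊆a ∘ below p }

regular-β : ∀ {C} → Regular C → Regular (β C)
regular-β {C} R = record
  { order          = cmpβ-order C order
  ; face-canonical = λ τ → proj₁ ∘ faceβ⇒ τ
  ; down-closed    = λ σ τ σ-face τ-can τ⊆σ →
      ⇒faceβ τ τ-can (λ p q → proj₂ (faceβ⇒ σ σ-face) (τ⊆σ p) (τ⊆σ q)) }
  where
  open Regular R
  open Subdivision C order

regular-β^ : ∀ {C} → Regular C → ∀ k → Regular (β^ k C)
regular-β^ R zero    = R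
regular-β^ R (suc k) = regular-β (regular-β^ R k)

regular-base : ∀ {n F} → IsComplex n F → Regular (baseCx n F)
regular-base {n} {F} IC = record
  { order          = cmpFin-order n
  ; face-canonical = λ σ → proj₁ ∘ Equivalence.to T-∧
  ; down-closed    = λ σ τ σ-face τ-can τ⊆σ → IsComplex.downClosed IC σ τ σ-face τ-can (λ _ → τ⊆σ) }

-- An elementary selection βC → C is simplicial: a chain σ₁ ⊂ ⋯ ⊂ σₖ is
-- mapped into its largest face σₖ, and faces are closed under subsets.
selection-simplicial : ∀ {C} → Regular C → ∀ {s} → IsSelection C s → Simplicial (β C) C s
selection-simplicial {C} R {s} s-sel τ τ-face =
  down-closed (proj₁ M) (image (β C) C s τ) (proj₂ M) (image-canonical s τ τ-nonEmpty) image⊆M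
  where
  open Regular R
  open Subdivision C order
  open Images (β C) C order using (image-canonical; ∈-image⁻)
  τ-chain : IsChain τ
  τ-chain = proj₂ (faceβ⇒ τ τ-face)
  τ-nonEmpty : NonEmpty τ
  τ-nonEmpty = proj₁ (Canonical.canonical⇒ (cmpβ-order C order) τ (proj₁ (faceβ⇒ τ τ-face)))
  M-max : Σ (Vβ C) λ M → M ∈ τ × (∀ {a} → a ∈ τ → proj₁ a ⊆ proj₁ M)
  M-max = chain-max τ τ-nonEmpty τ-chain
  M : Vβ C
  M = proj₁ M-max
  image⊆M : image (β C) C s τ ⊆ proj₁ M
  image⊆M m with a , a∈τ , refl ← ∈-image⁻ τ m = proj₂ (proj₂ M-max) a∈τ (s-sel a)

-- βf is simplicial whenever f is: images of a chain form a chain.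
β-simplicial : ∀ {C D} → IsCmpOrder (cmp C) → IsCmpOrder (cmp D) →
               ∀ {f} (p : Simplicial C D f) → Simplicial (β C) (β D) (βmap C D f p)
β-simplicial {C} {D} OC OD {f} p τ τ-face =
  ⇒faceβ _ (image-canonical (βmap C D f p) τ τ-nonEmpty) image-chain
  where
  open Subdivision D OD using (⇒faceβ)
  open Images (β C) (β D) (cmpβ-order D OD) using (image-canonical; ∈-image⁻)
  module SC = Subdivision C OC
  module SD = Subdivision D OD
  τ-nonEmpty : NonEmpty τ
  τ-nonEmpty = proj₁ (Canonical.canonical⇒ (cmpβ-order C OC) τ (proj₁ (SC.faceβ⇒ τ τ-face)))
  image-chain : SD.IsChain (image (β C) (β D) (βmap C D f p) τ)
  image-chain a∈ b∈
    with a , a∈τ , refl ← ∈-image⁻ τ a∈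
    with b , b∈τ , refl ← ∈-image⁻ τ b∈
    with proj₂ (SC.faceβ⇒ τ τ-face) a∈τ b∈τ
  ... | inj₁ a⊆b = inj₁ (Images.image-mono C D OD f a⊆b)
  ... | inj₂ b⊆a = inj₂ (Images.image-mono C D OD f b⊆a)

βmap-cong : ∀ {C D} {f g : V C → V D} (p : Simplicial C D f) (q : Simplicial C D g) →
            f ≗ g → βmap C D f p ≗ βmap C D g q
βmap-cong {C} {D} p q f≗g (σ , _) = face-≡ (image-cong {C} {D} f≗g σ)

selection-square : ∀ {C D} → IsCmpOrder (cmp D) → ∀ {t} → IsSelection D t →
                   ∀ {f} (p : Simplicial C D f) →
                   Σ (V (β C) → V C) λ u → IsSelection C u × (t ∘ βmap C D f p ≗ f ∘ u)
selection-square {C} {D} OD {t} t-sel {f} p =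
  (λ a → proj₁ (witness a)) , (λ a → proj₁ (proj₂ (witness a))) , (λ a → proj₂ (proj₂ (witness a)))
  where
  witness : ∀ a → Σ (V C) λ x → x ∈ proj₁ a × t (βmap C D f p a) ≡ f x
  witness a = Images.∈-image⁻ C D OD (proj₁ a) (t-sel (βmap C D f p a))

β-square : ∀ {C D₁ D₂ E} → IsCmpOrder (cmp D₁) → IsCmpOrder (cmp D₂) → IsCmpOrder (cmp E) →
           ∀ {a f b g} (pa : Simplicial C D₁ a) (pf : Simplicial D₁ E f)
             (pb : Simplicial C D₂ b) (pg : Simplicial D₂ E g) →
           f ∘ a ≗ g ∘ b → βmap D₁ E f pf ∘ βmap C D₁ a pa ≗ βmap D₂ E g pg ∘ βmap C D₂ b pb
β-square {C} {D₁} {D₂} {E} O₁ O₂ OE {a} {f} {b} {g} _ _ _ _ square (σ , _) = face-≡ (begin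
  image D₁ E f (image C D₁ a σ) ≡⟨ image-∘ {C} {D₁} {E} O₁ OE f a σ ⟩
  image C E (f ∘ a) σ           ≡⟨ image-cong {C} {E} square σ ⟩
  image C E (g ∘ b) σ           ≡⟨ image-∘ {C} {D₂} {E} O₂ OE g b σ ⟨
  image D₂ E g (image C D₂ b σ) ∎)
  where open ≡-Reasoning

≗id-simplicial : ∀ {C} → Regular C → ∀ {f} → f ≗ id → Simplicial C C f
≗id-simplicial {C} R f≗id σ σ-face =
  subst (IsFace C) (sym (image-id {C} (Regular.order R) f≗id (face-sorted R σ-face))) σ-face

βmap-≗id : ∀ {C} → Regular C → ∀ {f} → f ≗ id → (p : Simplicial C C f) → βmap C C f p ≗ id
βmap-≗id {C} R f≗id p (σ , σ-face) = face-≡ (image-id {C} (Regular.order R) f≗id (face-sorted R σ-face))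

-- Every face is non-empty, so every complex admits a selection: the first vertex.
first-vertex : ∀ {C} → Regular C → (a : Vβ C) → Σ (V C) (_∈ proj₁ a)
first-vertex R ((v ∷ _) , _) = v , here refl
first-vertex R ([] , []-face) = ⊥-elim (Regular.face-canonical R [] []-face)

∈⇒index : ∀ {H : Set} {h : H} xs → h ∈ xs → Σ ℕ λ i → head (drop i xs) ≡ just h
∈⇒index (_ ∷ _)  (here refl) = zero , refl
∈⇒index (_ ∷ xs) (there m)   = let i , e = ∈⇒index xs m in suc i , e

list-countable : ∀ {H : Set} {_≈_ : H → H → Set} (L : List H) →
                 (∀ h → Σ H λ h′ → h′ ∈ L × h′ ≈ h) → Countable H _≈_
list-countable L complete = (λ i → head (drop i L)) , λ h →
  let h′ , h′∈L , h′≈h = complete h ; i , e = ∈⇒index L h′∈L in i , h′ , e , h′≈h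

memberships : ∀ {X : Set} (xs : List X) → List (Σ X (_∈ xs))
memberships xs = mapWith∈ xs (λ {y} y∈ → y , y∈)

memberships-complete : ∀ {X : Set} {xs : List X} {y} (y∈ : y ∈ xs) → (y , y∈) ∈ memberships xs
memberships-complete y∈ = mapWith∈⁺ _ (_ , y∈ , refl)

sublists : ∀ {X : Set} → List X → List (List X)
sublists []      = [] ∷ []
sublists (y ∷ L) = sublists L ++ map (y ∷_) (sublists L)

[]∈sublists : ∀ {X : Set} (L : List X) → [] ∈ sublists L
[]∈sublists []      = here refl
[]∈sublists (y ∷ L) = ∈-++⁺ˡ ([]∈sublists L)

module _ {X : Set} {c : X → X → Cmp} (O : IsCmpOrder c) where
  open Canonical O

  sorted-sublist : ∀ {σ L} → Sorted c σ → Sorted c L → σ ⊆ L → σ ∈ sublists L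
  sorted-sublist {[]}    {L}     _ _ _ = []∈sublists L
  sorted-sublist {x ∷ σ} {[]}    _ _ σ⊆L with () ← σ⊆L (here refl)
  sorted-sublist {x ∷ σ} {y ∷ L} (x<σ ∷ σ-sorted) (y<L ∷ L-sorted) σ⊆L with σ⊆L (here refl)
  ... | here refl = ∈-++⁺ʳ (sublists L) (∈-map⁺ (y ∷_)
                      (sorted-sublist σ-sorted L-sorted (⊆-tail refl x<σ σ⊆L)))
  ... | there x∈L = ∈-++⁺ˡ (sorted-sublist (x<σ ∷ σ-sorted) L-sorted avoid-y)
    where
    -- y lies strictly below x ∈ L, hence below every element of x ∷ σ, so y ∉ x ∷ σ
    avoid-y : (x ∷ σ) ⊆ L
    avoid-y m with σ⊆L m
    ... | there m′  = m′
    avoid-y (here refl)  | here refl = ⊥-elim (<-irrefl (All.lookup y<L x∈L))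
    avoid-y (there z∈σ)  | here refl =
      ⊥-elim (<-asym (All.lookup y<L x∈L) (All.lookup x<σ z∈σ))

module DependentFunctions {X : Set} (_≟_ : DecidableEquality X) {P : X → Set}
                          (default : (x : X) → P x) (options : (x : X) → List (P x)) where

  patch : ((x : X) → P x) → (x : X) → P x → (z : X) → P z
  patch f x y z with z ≟ x
  ... | yes refl = y
  ... | no _     = f z

  functions : List X → List ((x : X) → P x)
  functions []       = default ∷ []
  functions (x ∷ xs) = cartesianProductWith (λ f → patch f x) (functions xs) (options x)

  functions-complete : (g : (x : X) → P x) → (∀ x → g x ∈ options x) → ∀ xs →
                       Σ ((x : X) → P x) λ f → f ∈ functions xs × (∀ {z} → z ∈ xs → f z ≡ g z)
  functions-complete g g-opt [] = default , here refl , λ ()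
  functions-complete g g-opt (x ∷ xs) with f , f∈ , f≡g ← functions-complete g g-opt xs =
    patch f x (g x) , ∈-cartesianProductWith⁺ (λ f → patch f x) f∈ (g-opt x) , agrees
    where
    agrees : ∀ {z} → z ∈ x ∷ xs → patch f x (g x) z ≡ g z
    agrees {z} z∈ with z ≟ x | z∈
    ... | yes refl | _         = refl
    ... | no z≢x   | here z≡x  = ⊥-elim (z≢x z≡x)
    ... | no _     | there z∈′ = f≡g z∈′

faces-in : ∀ C → List (List (V C)) → List (Vβ C)
faces-in C []       = []
faces-in C (σ ∷ σs) with T? (face C σ)
... | yes σ-face = (σ , σ-face) ∷ faces-in C σs
... | no _       = faces-in C σs

faces-in-complete : ∀ C {σs σ} (σ-face : IsFace C σ) → σ ∈ σs → (σ , σ-face) ∈ faces-in C σs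
faces-in-complete C {σ ∷ σs} σ-face (here refl) with T? (face C σ)
... | yes _      = here (face-≡ refl)
... | no ¬σ-face = ⊥-elim (¬σ-face σ-face)
faces-in-complete C {τ ∷ σs} σ-face (there σ∈) with T? (face C τ)
... | yes _ = there (faces-in-complete C σ-face σ∈)
... | no _  = faces-in-complete C σ-face σ∈

module SelectionCategory (A : Cx) (RA : Regular A) where

  B : ℕ → Cx
  B k = β^ k A

  R : ∀ k → Regular (B k)
  R = regular-β^ RA

  O : ∀ k → IsCmpOrder (cmp (B k))
  O k = Regular.order (R k)

  InS≗ : ∀ m k → (V (B m) → V (B k)) → Set
  InS≗ m k f = Σ (V (B m) → V (B k)) λ f′ → InS A m k f′ × f′ ≗ f

  -- the identity of β^k A is the k-fold subdivision of 1_A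
  identity : ∀ k → InS≗ k k id
  identity zero    = id , idA , λ _ → refl
  identity (suc k) with f , f-inS , f≗id ← identity k =
    βmap (B k) (B k) f p , bet p f-inS , βmap-≗id (R k) f≗id p
    where
    p : Simplicial (B k) (B k) f
    p = ≗id-simplicial (R k) f≗id

  data Gen : (l : ℕ) → (V (B (suc l)) → V (B l)) → Set where
    sel : ∀ {l s} → IsSelection (B l) s → Gen l s
    bet : ∀ {l f} (p : Simplicial (B (suc l)) (B l) f) → Gen l f →
          Gen (suc l) (βmap (B (suc l)) (B l) f p)

  gen-simplicial : ∀ {l f} → Gen l f → Simplicial (B (suc l)) (B l) f
  gen-simplicial {l} (sel s-sel) = selection-simplicial (R l) s-sel
  gen-simplicial {suc l} (bet p _) = β-simplicial (O (suc l)) (O l) p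

  gen-inS : ∀ {l f} → Gen l f → InS A (suc l) l f
  gen-inS {l} (sel s-sel) = sel l _ s-sel
  gen-inS (bet p G)       = bet p (gen-inS G)

  data Path : (m k : ℕ) → (V (B m) → V (B k)) → Set where
    nil  : ∀ k → Path k k id
    cons : ∀ {m k f g} → Gen k g → Path m (suc k) f → Path m k (g ∘ f)

  path-inS : ∀ {m k f} → Path m k f → InS≗ m k f
  path-inS (nil k) = identity k
  path-inS (cons {g = g} G P) with f , f-inS , f≗ ← path-inS P =
    g ∘ f , comp (gen-inS G) f-inS , cong g ∘ f≗

  _++ₚ_ : ∀ {n m k f g} → Path m k f → Path n m g → Path n k (f ∘ g)
  nil _    ++ₚ Q = Q
  cons G P ++ₚ Q = cons G (P ++ₚ Q)

  β-path : ∀ {m k g} → Path m k g →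
           Σ (V (B (suc m)) → V (B (suc k))) λ g′ →
             Path (suc m) (suc k) g′ × (∀ a → proj₁ (g′ a) ≡ image (B m) (B k) g (proj₁ a))
  β-path (nil k) = id , nil (suc k) , λ (σ , σ-face) →
    sym (image-id {B k} (O k) (λ _ → refl) (face-sorted (R k) σ-face))
  β-path {m} {k} (cons {f = f} {g = g} G P) with g′ , P′ , g′-image ← β-path P =
    βmap (B (suc k)) (B k) g (gen-simplicial G) ∘ g′ , cons (bet (gen-simplicial G) G) P′ , λ a → begin
      image (B (suc k)) (B k) g (proj₁ (g′ a))     ≡⟨ cong (image (B (suc k)) (B k) g) (g′-image a) ⟩
      image (B (suc k)) (B k) g (image (B m) (B (suc k)) f (proj₁ a))
        ≡⟨ image-∘ {B m} {B (suc k)} {B k} (O (suc k)) (O k) g f (proj₁ a) ⟩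
      image (B m) (B k) (g ∘ f) (proj₁ a)          ∎
    where open ≡-Reasoning

  normal-form : ∀ {m k f} → InS A m k f → Σ (V (B m) → V (B k)) λ g → Path m k g × f ≗ g
  normal-form (sel k s s-sel) = s ∘ id , cons (sel s-sel) (nil (suc k)) , λ _ → refl
  normal-form idA             = id , nil 0 , λ _ → refl
  normal-form (comp {f = f} F G)
    with g₁ , P₁ , f≗g₁ ← normal-form F | g₂ , P₂ , g≗g₂ ← normal-form G =
    g₁ ∘ g₂ , P₁ ++ₚ P₂ , λ x → trans (cong f (g≗g₂ x)) (f≗g₁ _)
  normal-form (bet {m} {k} {f} p F)
    with g , P , f≗g ← normal-form F with g′ , P′ , g′-image ← β-path P =
    g′ , P′ , λ (σ , _) → face-≡ (trans (image-cong {B m} {B k} f≗g σ) (sym (g′-image _)))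

  GenSquare : ∀ l → (f g : V (B (suc l)) → V (B l)) → Set
  GenSquare l f g = Σ (V (B (suc (suc l))) → V (B (suc l))) λ a →
                      Σ (V (B (suc (suc l))) → V (B (suc l))) λ b →
                      Gen (suc l) a × Gen (suc l) b × (f ∘ a ≗ g ∘ b)

  flip-square : ∀ {l} {f g : V (B (suc l)) → V (B l)} → GenSquare l f g → GenSquare l g f
  flip-square (a , b , Ga , Gb , square) = b , a , Gb , Ga , λ x → sym (square x)

  selection-gen-square : ∀ {l t h} → IsSelection (B l) t → Gen l h → GenSquare l t h
  selection-gen-square {l} t-sel H
    with u , u-sel , square ← selection-square {B (suc l)} {B l} (O l) t-sel (gen-simplicial H) =
    _ , u , bet (gen-simplicial H) H , sel u-sel , square

  gen-square : ∀ {l f g} → Gen l f → Gen l g → GenSquare l f g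
  gen-square (sel t-sel)   G           = selection-gen-square t-sel G
  gen-square {suc l} {f} {g} F@(bet _ _) (sel t-sel) =
    flip-square {suc l} {g} {f} (selection-gen-square t-sel F)
  gen-square {suc l} (bet pf F) (bet pg G) with a , b , Ga , Gb , square ← gen-square F G =
    _ , _ , bet (gen-simplicial Ga) Ga , bet (gen-simplicial Gb) Gb ,
    β-square {B (suc (suc l))} {B (suc l)} {B (suc l)} {B l}
      (O (suc l)) (O (suc l)) (O l) (gen-simplicial Ga) pf (gen-simplicial Gb) pg square

  gen-path-square : ∀ {l n g q} → Gen l g → Path n l q →
    Σ (V (B (suc n)) → V (B (suc l))) λ p → Σ (V (B (suc n)) → V (B n)) λ d →
      Path (suc n) (suc l) p × Gen n d × (g ∘ p ≗ q ∘ d)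
  gen-path-square G (nil _) = id , _ , nil _ , G , λ _ → refl
  gen-path-square G (cons {g = h} H Q)
    with a , b , Ga , Gb , square ← gen-square G H
    with p , d , P , D , square′ ← gen-path-square Gb Q =
    _ , d , cons Ga P , D , λ x → trans (square (p x)) (cong h (square′ x))

  path-square : ∀ {m n k p q} → Path m k p → Path n k q →
    Σ ℕ λ o → Σ (V (B o) → V (B m)) λ x → Σ (V (B o) → V (B n)) λ y →
      Path o m x × Path o n y × (p ∘ x ≗ q ∘ y)
  path-square {n = n} {q = q} (nil _) Q = n , q , id , Q , nil n , λ _ → refl
  path-square (cons {g = g} G P)    Q
    with p , d , P′ , D , square ← gen-path-square G Q
    with o , x , y , X , Y , square′ ← path-square P P′ =
    o , x , _ , X , cons D Y , λ z → trans (cong g (square′ z)) (square (y z))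

  amalgamation : ∀ {o₁ o₂ o₃} (e₁ : Hom A o₁ o₃) (e₂ : Hom A o₂ o₃) →
    Σ ℕ λ o → Σ (Hom A o o₁) λ e₁′ → Σ (Hom A o o₂) λ e₂′ →
      ∀ x → proj₁ e₁ (proj₁ e₁′ x) ≡ proj₁ e₂ (proj₁ e₂′ x)
  amalgamation (f₁ , F₁) (f₂ , F₂)
    with g₁ , P₁ , f₁≗g₁ ← normal-form F₁ | g₂ , P₂ , f₂≗g₂ ← normal-form F₂
    with o , x , y , X , Y , square ← path-square P₁ P₂
    with x′ , x′-inS , x′≗x ← path-inS X | y′ , y′-inS , y′≗y ← path-inS Y =
    o , (x′ , x′-inS) , (y′ , y′-inS) , λ z → begin
      f₁ (x′ z) ≡⟨ cong f₁ (x′≗x z) ⟩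
      f₁ (x z)  ≡⟨ f₁≗g₁ (x z) ⟩
      g₁ (x z)  ≡⟨ square z ⟩
      g₂ (y z)  ≡⟨ f₂≗g₂ (y z) ⟨
      f₂ (y z)  ≡⟨ cong f₂ (y′≗y z) ⟨
      f₂ (y′ z) ∎
    where open ≡-Reasoning

  descend : ∀ d k → Hom A (d + k) k
  descend zero    k = let f , f-inS , _ = identity k in f , f-inS
  descend (suc d) k = let f , f-inS = descend d k in
    _ , comp f-inS (sel (d + k) (proj₁ ∘ first-vertex (R (d + k))) (proj₂ ∘ first-vertex (R (d + k))))

  joint-projection : ∀ o₁ o₂ → Σ ℕ λ o → Hom A o o₁ × Hom A o o₂
  joint-projection o₁ o₂ = o₂ + o₁ , descend o₂ o₁ , subst (λ o → Hom A o o₂) (+-comm o₁ o₂) (descend o₁ o₂)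

  countable-objects : Σ (ℕ → ℕ) λ e → ∀ k → Σ ℕ λ n → Iso A (e n) k
  countable-objects = id , λ k → let f , f-inS , f≗id = identity k in
    k , (f , f-inS) , (f , f-inS) , (λ x → trans (f≗id _) (f≗id x)) , (λ x → trans (f≗id _) (f≗id x))

-- If A has finitely many vertices, then S(A) has countably many morphisms
-- between any two objects: generators are finitely many up to pointwise
-- equality, and a morphism β^m A → β^k A is a path of m − k generators.
module Countability (A : Cx) (RA : Regular A)
                    (vertices : List (V A)) (all-vertices : ∀ v → v ∈ vertices) where
  open SelectionCategory A RA

  -- every β^k A has a finite list of vertices: its faces are sorted
  -- sub-lists of the sorted list of vertices of β^(k-1) A
  vertices-at : ∀ k → List (V (B k))
  vertices-at zero    = vertices
  vertices-at (suc k) = faces-in (B k) (sublists (normalize (cmp (B k)) (vertices-at k)))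

  all-vertices-at : ∀ k x → x ∈ vertices-at k
  all-vertices-at zero    = all-vertices
  all-vertices-at (suc k) (σ , σ-face) = faces-in-complete (B k) σ-face
    (sorted-sublist (O k) (face-sorted (R k) σ-face) (normalize-sorted (vertices-at k))
      (λ {x} _ → ∈-normalize⁺ (vertices-at k) (all-vertices-at k x)))
    where open Canonical (O k)

  -- selections β^(l+1) A → β^l A are the dependent functions a ↦ (v , v ∈ a)
  module Choices (l : ℕ) = DependentFunctions (Canonical._≟_ (O (suc l)))
    {λ a → Σ (V (B l)) (_∈ proj₁ a)} (first-vertex (R l)) (memberships ∘ proj₁)

  GenΣ : ℕ → Set
  GenΣ l = Σ (V (B (suc l)) → V (B l)) (Gen l)

  selection-gens : ∀ l → List (GenΣ l)
  selection-gens l = map (λ f → proj₁ ∘ f , sel (proj₂ ∘ f)) (Choices.functions l (vertices-at (suc l)))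

  selection-gens-complete : ∀ {l s} (s-sel : IsSelection (B l) s) →
                            Σ (GenΣ l) λ g → g ∈ selection-gens l × proj₁ g ≗ s
  selection-gens-complete {l} {s} s-sel
    with f , f∈ , f≡ ← Choices.functions-complete l (λ a → s a , s-sel a)
                         (λ a → memberships-complete (s-sel a)) (vertices-at (suc l)) =
    _ , ∈-map⁺ _ f∈ , λ a → cong proj₁ (f≡ (all-vertices-at (suc l) a))

  gens : ∀ l → List (GenΣ l)
  gens-β : ∀ l → List (GenΣ l)
  gens l = selection-gens l ++ gens-β l
  gens-β zero    = []
  gens-β (suc l) = map (λ (f , G) → βmap (B (suc l)) (B l) f (gen-simplicial G) , bet _ G) (gens l)

  gens-complete : ∀ {l f} → Gen l f → Σ (GenΣ l) λ g → g ∈ gens l × proj₁ g ≗ f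
  gens-complete {l} (sel s-sel) with g , g∈ , g≗ ← selection-gens-complete {l} s-sel =
    g , ∈-++⁺ˡ g∈ , g≗
  gens-complete {suc l} (bet p F) with (f′ , F′) , F′∈ , f′≗f ← gens-complete F =
    _ , ∈-++⁺ʳ (selection-gens (suc l)) (∈-map⁺ _ F′∈) ,
    βmap-cong {B (suc l)} {B l} (gen-simplicial F′) p f′≗f

  PathΣ : ℕ → ℕ → Set
  PathΣ m k = Σ (V (B m) → V (B k)) (Path m k)

  length : ∀ {m k f} → Path m k f → ℕ
  length (nil _)    = 0
  length (cons _ P) = suc (length P)

  length-+ : ∀ {m k f} (P : Path m k f) → length P + k ≡ m
  length-+ (nil _)              = refl
  length-+ {k = k} (cons _ P)   = trans (sym (+-suc (length P) k)) (length-+ P)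

  identity-paths : ∀ m k → List (PathΣ m k)
  identity-paths m k with m ≟ℕ k
  ... | yes refl = (id , nil m) ∷ []
  ... | no _     = []

  identity-paths-complete : ∀ m → (id , nil m) ∈ identity-paths m m
  identity-paths-complete m with m ≟ℕ m
  ... | yes refl = here refl
  ... | no m≢m   = ⊥-elim (m≢m refl)

  paths : ℕ → ∀ m k → List (PathΣ m k)
  paths zero    m k = identity-paths m k
  paths (suc n) m k = identity-paths m k ++
    cartesianProductWith (λ (g , G) (f , P) → g ∘ f , cons G P) (gens k) (paths n m (suc k))

  paths-complete : ∀ n {m k f} (P : Path m k f) → length P ≤ n →
                   Σ (PathΣ m k) λ Q → Q ∈ paths n m k × proj₁ Q ≗ f
  paths-complete zero    (nil m) _ = _ , identity-paths-complete m , λ _ → refl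
  paths-complete (suc n) (nil m) _ = _ , ∈-++⁺ˡ (identity-paths-complete m) , λ _ → refl
  paths-complete (suc n) {m} {k} (cons {f = f} G P) (s≤s length≤n)
    with (g′ , G′) , G′∈ , g′≗g ← gens-complete G
    with (f′ , P′) , P′∈ , f′≗f ← paths-complete n P length≤n =
    _ , ∈-++⁺ʳ (identity-paths m k) (∈-cartesianProductWith⁺ _ G′∈ P′∈) ,
    λ x → trans (cong g′ (f′≗f x)) (g′≗g (f x))

  countable-homs : ∀ m k → Countable (Hom A m k) _≈ₕ_
  countable-homs m k = list-countable (map as-hom (paths m m k)) complete
    where
    as-hom : PathΣ m k → Hom A m k
    as-hom (_ , P) = let f , f-inS , _ = path-inS P in f , f-inS

    complete : ∀ h → Σ (Hom A m k) λ h′ → h′ ∈ map as-hom (paths m m k) × h′ ≈ₕ h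
    complete (f , F)
      with g , P , f≗g ← normal-form F
      with (g′ , P′) , P′∈ , g′≗g ← paths-complete m P
             (≤-trans (m≤m+n (length P) k) (≤-reflexive (length-+ P))) =
      as-hom (g′ , P′) , ∈-map⁺ as-hom P′∈ ,
      λ x → trans (proj₂ (proj₂ (path-inS P′)) x) (trans (g′≗g x) (sym (f≗g x)))

projective-fraisse : ∀ A → Regular A → (vertices : List (V A)) → (∀ v → v ∈ vertices) → ProjFraisse A
projective-fraisse A RA vertices all-vertices = record
  { countableObjects = countable-objects
  ; countableHoms    = countable-homs
  ; jointProjection  = joint-projection
  ; amalgamation     = amalgamation }
  where
  open SelectionCategory A RA
  open Countability A RA vertices all-vertices

theorem3p2 : (n : ℕ) (F : List (Fin n) → Bool) → IsComplex n F → ProjFraisse (baseCx n F)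
theorem3p2 n F IC = projective-fraisse (baseCx n F) (regular-base IC) (allFin n) ∈-allFin
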